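{- Let $D$ be a canonical split decomposition and let $B$ be a bag of $D$ containing two unmarked vertices $a$ and $b$. Let $D_1,\dots,D_\ell$ be the components of $D\setminus V(B)$ and let $k:=\max\{\operatorname{lrw}(\hat{D_i}) : 1\le i\le \ell\}$. If $B$ has a linear layout of width at most $p\ge 1$ whose first and last vertices are $a$ and $b$ respectively, then $\hat D$ has a linear layout of width at most $2p+k$ whose first and last vertices are $a$ and $b$ respectively.
   Context: A marked graph is a connected graph $D$ with a matching $M(D)$ of cut-edges (marked edges); their ends are marked vertices, the others unmarked; bags are the components of $(V(D),E(D)\setminus M(D))$. For a marked graph $D$, $\hat D$ is the graph on the unmarked vertices of $D$ in which two vertices are adjacent iff $D$ has a path between them whose edges alternate between unmarked and marked edges (starting and ending with unmarked ones). A split decomposition of a connected graph $G$ is obtained from $G$ by repeatedly replacing a bag $H$ with a split $(X,Y)$ (a partition with $|X|,|Y|\ge2$ such that the $X$–$Y$ edges form a complete bipartite graph between nonempty $X'\subseteq X$, $Y'\subseteq Y$) by $H[X]\cup H[Y]$, two new vertices $x',y'$, a marked edge $x'y'$, and edges from $x'$ to vertices of $X$ with a neighbour in $Y$ and from $y'$ to vertices of $Y$ with a neighbour in $X$; then $\hat D=G$. The canonical split decomposition is the unique one whose bags are prime, stars or complete and which is not a refinement of another such one. For a component $D_i$ of $D\setminus V(B)$, the vertex of $D_i$ joined by a marked edge to $B$ is regarded as an unmarked vertex of $D_i$, so that $D_i$ is a marked graph and $\hat{D_i}$ is defined. A bag is regarded as a graph. Linear layout and linear rank-width: for $X\subseteq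 V(G)$, $\operatorname{cutrk}_G(X)$ is the GF(2)-rank of the adjacency submatrix with rows $X$, columns $V(G)\setminus X$; a linear layout is an ordering $(x_1,\dots,x_n)$ of $V(G)$ of width $\max_{i<n}\operatorname{cutrk}_G(\{x_1,\dots,x_i\})$; $\operatorname{lrw}(G)$ is the minimum width ($0$ if $|V(G)|\le 1$). -}

module Defs where

open import Data.Nat using (ℕ; zero; suc; _<_)
open import Data.Fin using (Fin)
open import Data.Bool using (Bool; true; false; not)
open import Data.List using (List; []; _∷_; _++_; length)
open import Data.List.Membership.Propositional using (_∈_)
open import Data.List.Relation.Unary.Unique.Propositional using (Unique)
open import Data.List.Relation.Binary.Sublist.Propositional using (_⊆_)
open import Data.Product using (Σ; _×_; _,_; ∃)
open import Data.Sum using (_⊎_)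
open import Data.Unit using (⊤)
open import Relation.Nullary using (¬_)
open import Relation.Binary.PropositionalEquality using (_≡_; _≢_)
open import Function.Bundles using (_⇔_)
open import Level using (0ℓ) renaming (suc to lsuc)

data Reach {n : ℕ} (E : Fin n → Fin n → Set) : Fin n → Fin n → Set where
  here : ∀ {u} → Reach E u u
  step : ∀ {u v w} → E u v → Reach E v w → Reach E u w

NotEdge : ∀ {n} → Fin n → Fin n → Fin n → Fin n → Set
NotEdge u v x y = ¬ ((x ≡ u × y ≡ v) ⊎ (x ≡ v × y ≡ u))

record MarkedGraph (n : ℕ) : Set where
  field
    adj         : Fin n → Fin n → Bool
    adj-sym     : ∀ u v → adj u v ≡ adj v u
    adj-irrefl  : ∀ u → adj u u ≡ false
    mk          : Fin n → Fin n → Bool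
    mk-sym      : ∀ u v → mk u v ≡ mk v u
    mk⊆adj      : ∀ u v → mk u v ≡ true → adj u v ≡ true
    mk-matching : ∀ u v w → mk u v ≡ true → mk u w ≡ true → v ≡ w
    mk-cut      : ∀ u v → mk u v ≡ true →
                  ¬ Reach (λ x y → adj x y ≡ true × NotEdge u v x y) u v
    connected   : ∀ u v → Reach (λ x y → adj x y ≡ true) u v

open MarkedGraph public

module _ {n : ℕ} (D : MarkedGraph n) where

  Unmarked : Fin n → Set
  Unmarked u = ∀ v → mk D u v ≡ false

  UEdge : Fin n → Fin n → Set
  UEdge u v = adj D u v ≡ true × mk D u v ≡ false

  -- u and v lie in the same bag (component of (V(D), E(D) ∖ M(D)))
  SameBag : Fin n → Fin n → Set
  SameBag u v = Reach UEdge u v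

  -- A split (X,Y) of the bag H containing h; X = H ∩ {inX = true},
  -- Y = H ∩ {inX = false}.
  record BagSplit (h : Fin n) (inX : Fin n → Bool) : Set where
    field
      X-two   : Σ (Fin n) λ x₁ → Σ (Fin n) λ x₂ → x₁ ≢ x₂ ×
                SameBag h x₁ × inX x₁ ≡ true × SameBag h x₂ × inX x₂ ≡ true
      Y-two   : Σ (Fin n) λ y₁ → Σ (Fin n) λ y₂ → y₁ ≢ y₂ ×
                SameBag h y₁ × inX y₁ ≡ false × SameBag h y₂ × inX y₂ ≡ false
      nonempty : Σ (Fin n) λ x → Σ (Fin n) λ y →
                 SameBag h x × inX x ≡ true × SameBag h y × inX y ≡ false ×
                 adj D x y ≡ true
      -- X–Y edges form a complete bipartite graph between
      -- X' = {x ∈ X : x has a neighbour in Y} and Y' = {y ∈ Y : y has a neighbour in X}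
      complete : ∀ x y x₂ y₂ →
                 SameBag h x → inX x ≡ true → SameBag h x₂ → inX x₂ ≡ true →
                 SameBag h y → inX y ≡ false → SameBag h y₂ → inX y₂ ≡ false →
                 adj D x y₂ ≡ true → adj D x₂ y ≡ true → adj D x y ≡ true

  PrimeBag : Fin n → Set
  PrimeBag h = ∀ inX → ¬ BagSplit h inX

  CompleteBag : Fin n → Set
  CompleteBag h = ∀ u v → SameBag h u → SameBag h v → u ≢ v → adj D u v ≡ true

  StarBag : Fin n → Set
  StarBag h = Σ (Fin n) λ c → SameBag h c ×
              (∀ v → SameBag h v → v ≢ c → adj D c v ≡ true) ×
              (∀ u v → SameBag h u → SameBag h v → u ≢ c → v ≢ c → adj D u v ≡ false)

  AllBagsPSC : Set
  AllBagsPSC = ∀ h → PrimeBag h ⊎ StarBag h ⊎ CompleteBag h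

-- One split step: D' is obtained from D by splitting a bag.  The vertices
-- of D are embedded into D' by the injection ι, the two new vertices are
-- x' and y' (with the marked edge x'y').

record SplitStep {n : ℕ} (D : MarkedGraph n) (D' : MarkedGraph (suc (suc n))) : Set where
  field
    ι      : Fin n → Fin (suc (suc n))
    ι-inj  : ∀ u v → ι u ≡ ι v → u ≡ v
    x' y'  : Fin (suc (suc n))
    x'≢y'  : x' ≢ y'
    x'-new : ∀ u → ι u ≢ x'
    y'-new : ∀ u → ι u ≢ y'
    h      : Fin n
    inX    : Fin n → Bool
    split  : BagSplit D h inX
    adj-cross : ∀ u v → SameBag D h u → SameBag D h v → inX u ≢ inX v →
                adj D' (ι u) (ι v) ≡ false
    adj-keep  : ∀ u v → ¬ (SameBag D h u × SameBag D h v × inX u ≢ inX v) →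
                adj D' (ι u) (ι v) ≡ adj D u v
    adj-x'y'  : adj D' x' y' ≡ true
    adj-x'    : ∀ u → (adj D' x' (ι u) ≡ true) ⇔
                (SameBag D h u × inX u ≡ true ×
                 Σ (Fin n) λ v → SameBag D h v × inX v ≡ false × adj D u v ≡ true)
    adj-y'    : ∀ u → (adj D' y' (ι u) ≡ true) ⇔
                (SameBag D h u × inX u ≡ false ×
                 Σ (Fin n) λ v → SameBag D h v × inX v ≡ true × adj D u v ≡ true)
    mk-old    : ∀ u v → mk D' (ι u) (ι v) ≡ mk D u v
    mk-x'y'   : mk D' x' y' ≡ true
    mk-x'     : ∀ u → mk D' x' (ι u) ≡ false
    mk-y'     : ∀ u → mk D' y' (ι u) ≡ false

data Steps : ∀ {m n} → MarkedGraph m → MarkedGraph n → Set where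
  done  : ∀ {m} {D : MarkedGraph m} → Steps D D
  split : ∀ {m n} {D : MarkedGraph m} {D' : MarkedGraph (suc (suc m))}
            {D'' : MarkedGraph n} →
          SplitStep D D' → Steps D' D'' → Steps D D''

Steps⁺ : ∀ {m n} → MarkedGraph m → MarkedGraph n → Set
Steps⁺ {m} D D'' = Σ (MarkedGraph (suc (suc m))) λ D' → SplitStep D D' × Steps D' D''

-- D is a split decomposition (of the connected graph G, a marked graph
-- without marked edges; then D̂ ≅ G)
IsSplitDecomposition : ∀ {n} → MarkedGraph n → Set
IsSplitDecomposition D =
  Σ ℕ λ m → Σ (MarkedGraph m) λ G → (∀ u v → mk G u v ≡ false) × Steps G D

Canonical : ∀ {n} → MarkedGraph n → Set
Canonical {n} D =
  IsSplitDecomposition D × AllBagsPSC D ×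
  (∀ {m} (D' : MarkedGraph m) → IsSplitDecomposition D' → AllBagsPSC D' →
     ¬ Steps⁺ D' D)

record SubGraph (n : ℕ) : Set₁ where
  field
    V : Fin n → Set
    E : Fin n → Fin n → Set

open SubGraph public

data Parity {n : ℕ} (P : Fin n → Set) : List (Fin n) → Bool → Set where
  nil : Parity P [] false
  yes : ∀ {x xs b} → P x → Parity P xs b → Parity P (x ∷ xs) (not b)
  no  : ∀ {x xs b} → ¬ P x → Parity P xs b → Parity P (x ∷ xs) b

-- cutrk_G(X) ≤ w, where rows X and columns Y (= the rest of the vertices):
-- the GF(2)-rank (maximal number of linearly independent rows) is ≤ w, i.e.
-- every family of more than w distinct rows has a nonempty subfamily
-- summing to zero over GF(2).
CutRankAtMost : ∀ {n} → SubGraph n → List (Fin n) → List (Fin n) → ℕ → Set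
CutRankAtMost {n} G X Y w =
  ∀ (T : List (Fin n)) → T ⊆ X → w < length T →
  Σ (List (Fin n)) λ T' → T' ⊆ T × 0 < length T' ×
    (∀ c → c ∈ Y → Parity (λ r → E G r c) T' false)

Layout : ∀ {n} → SubGraph n → List (Fin n) → Set
Layout G L = Unique L × (∀ v → v ∈ L → V G v) × (∀ v → V G v → v ∈ L)

WidthAtMost : ∀ {n} → SubGraph n → List (Fin n) → ℕ → Set
WidthAtMost G L w = ∀ X Y → L ≡ X ++ Y → CutRankAtMost G X Y w

LrwAtMost : ∀ {n} → SubGraph n → ℕ → Set
LrwAtMost G k = Σ _ λ L → Layout G L × WidthAtMost G L k

module _ {n : ℕ} (D : MarkedGraph n) where

  data Alt (S : Fin n → Set) : Fin n → Fin n → Set where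
    one  : ∀ {u v} → S u → S v → UEdge D u v → Alt S u v
    more : ∀ {u w w' v} → S u → S w → S w' → UEdge D u w →
           mk D w w' ≡ true → Alt S w' v → Alt S u v

  -- the marked graph induced on S (marked edges leaving S are dropped, so their
  -- ends in S count as unmarked), and its hat graph
  hat : (Fin n → Set) → SubGraph n
  hat S = record
    { V = λ u → S u × (∀ v → S v → mk D u v ≡ false)
    ; E = Alt S }

  hatD : SubGraph n
  hatD = hat (λ _ → ⊤)

  bagGraph : Fin n → SubGraph n
  bagGraph a = record
    { V = SameBag D a
    ; E = λ u v → adj D u v ≡ true }

  Comp : Fin n → Fin n → Fin n → Set
  Comp a r v = Reach (λ x y → adj D x y ≡ true × ¬ SameBag D a x × ¬ SameBag D a y) r v

-- Every vertex x of D lies in the block of exactly one bag vertex v: x = v, or x lies in the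
-- component of D ∖ V(B) attached to v by a marked edge vw.  Replacing every v in the layout of B
-- by the unmarked vertices of its block, in the order of a layout of the hat graph of that
-- component, gives a layout of D̂ from a to b.  Vertices x, c of different blocks v ≠ v′ are
-- adjacent in D̂ iff vv′ ∈ E(B) and x, c are linked to v, v′ (equal to them, or adjacent to the
-- marked end in the hat graph of their component).  So at a cut inside the block of v the rows
-- from earlier blocks have rank at most p, and the rows from the block of v have rank at most k
-- on the columns of their component plus one for all remaining columns: rank ≤ p + k + 1 ≤ 2p + k.

module Submission where

open import Defs hiding (yes; no)
open import Data.Nat using (ℕ; zero; suc; _≤_; _<_; _+_; _*_; z≤n; s≤s; _<?_)
open import Data.Nat.Properties
  using (≤-refl; ≤-reflexive; ≤-trans; ≤-<-trans; ≤-pred; <-irrefl; ≮⇒≥; ≰⇒>; <⇒≱; n≤1+n; m≤m+n;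
         +-suc; +-assoc; +-identityʳ; +-monoˡ-≤; +-monoʳ-≤; +-mono-≤)
open import Data.Fin using (Fin) renaming (_≟_ to _≟ᶠ_)
open import Data.Fin.Properties using (any?)
open import Data.Fin.Subset using (Subset; ⁅_⁆; _∪_; ∣_∣) renaming (_∈_ to _∈ₛ_; _∉_ to _∉ₛ_)
open import Data.Fin.Subset.Properties
  using (p⊆p∪q; x∈p∪q⁺; x∈p∪q⁻; x∈⁅x⁆; x∈⁅y⁆⇒x≡y; ∣p∣≤n; p⊂q⇒∣p∣<∣q∣) renaming (_∈?_ to _∈ₛ?_)
open import Data.Bool using (Bool; true; false; not; _∧_; _xor_)
open import Data.Bool.Properties
  using (xor-same; xor-assoc; xor-comm; xor-identityʳ; ∧-distribʳ-xor) renaming (_≟_ to _≟ᵇ_)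
open import Data.List using (List; []; _∷_; _++_; length; map; filter; concatMap; head; last; [_])
open import Data.List.Properties
  using (∷-injective; length-++; length-map; ++-assoc; ++-identityʳ; ++-conicalˡ; ++-conicalʳ;
         filter-accept; filter-reject)
open import Data.List.Membership.Propositional using (_∈_; _∉_; find; lose)
open import Data.List.Membership.Propositional.Properties
  using (∈-++⁺ˡ; ∈-++⁺ʳ; ∈-++⁻; ∈-concatMap⁺; ∈-concatMap⁻; ∈-filter⁺; ∈-filter⁻)
open import Data.List.Relation.Unary.Any using (Any; here; there) renaming (any? to anyᴸ?)
open import Data.List.Relation.Unary.All using ([])
open import Data.List.Relation.Unary.AllPairs using ([]; _∷_)
open import Data.List.Relation.Unary.Unique.Propositional using (Unique)
import Data.List.Relation.Unary.Unique.Propositional.Properties as Unique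
open import Data.List.Relation.Binary.Sublist.Propositional
  using (_⊆_; []; _∷_; _∷ʳ_; ⊆-refl; ⊆-trans; from∈)
open import Data.List.Relation.Binary.Sublist.Propositional.Properties
  using ([]⊆-universal; ++⁺ˡ; ++⁺ʳ; Any-resp-⊆; filter-⊆; length-mono-≤)
open import Data.Maybe using (just)
open import Data.Product using (Σ; ∃; ∃₂; _×_; _,_; proj₁; proj₂)
open import Data.Sum using (_⊎_; inj₁; inj₂)
open import Data.Empty using (⊥)
open import Data.Unit using (⊤; tt)
open import Relation.Nullary using (¬_; Dec; yes; no; does; contradiction)
open import Relation.Nullary.Decidable using (_×-dec_; _⊎-dec_; ¬?; map′; does-⇔)
open import Function.Bundles using (mk⇔)
open import Relation.Binary.PropositionalEquality
  using (_≡_; _≢_; refl; sym; trans; cong; cong₂; subst; module ≡-Reasoning)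
open import Function using (_∘_)

open ≡-Reasoning

module _ {n : ℕ} {E : Fin n → Fin n → Set} where

  Reach-trans : ∀ {u v w} → Reach E u v → Reach E v w → Reach E u w
  Reach-trans here q = q
  Reach-trans (step e p) q = step e (Reach-trans p q)

  Reach-snoc : ∀ {u v w} → Reach E u v → E v w → Reach E u w
  Reach-snoc p e = Reach-trans p (step e here)

  Reach-sym : (∀ {x y} → E x y → E y x) → ∀ {u v} → Reach E u v → Reach E v u
  Reach-sym sym-E here = here
  Reach-sym sym-E (step e p) = Reach-snoc (Reach-sym sym-E p) (sym-E e)

  Reach-closed : (P : Fin n → Set) → (∀ {x y} → P x → E x y → P y) →
                 ∀ {u v} → P u → Reach E u v → P v
  Reach-closed P closed pu here = pu
  Reach-closed P closed pu (step e r) = Reach-closed P closed (closed pu e) r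

  Reach-map : {F : Fin n → Fin n → Set} → (∀ {x y} → E x y → F x y) →
              ∀ {u v} → Reach E u v → Reach F u v
  Reach-map f here = here
  Reach-map f (step e p) = step (f e) (Reach-map f p)

-- The set of vertices reachable from u is computed by growing {u} along edges leaving it;
-- the fuel bounds the number of vertices still missing.
module ReachDecidable {n : ℕ} (E : Fin n → Fin n → Set) (E? : ∀ x y → Dec (E x y)) (u : Fin n) where

  Sound : Subset n → Set
  Sound S = ∀ {x} → x ∈ₛ S → Reach E u x

  Closed : Subset n → Set
  Closed S = ∀ {x y} → x ∈ₛ S → E x y → y ∈ₛ S

  ExitEdge : Subset n → Set
  ExitEdge S = ∃₂ λ x y → x ∈ₛ S × y ∉ₛ S × E x y

  exitEdge? : ∀ S → Dec (ExitEdge S)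
  exitEdge? S = any? λ x → any? λ y → (x ∈ₛ? S) ×-dec ¬? (y ∈ₛ? S) ×-dec E? x y

  no-exitEdge⇒Closed : ∀ {S} → ¬ ExitEdge S → Closed S
  no-exitEdge⇒Closed {S} ¬exit {x} {y} x∈S e with y ∈ₛ? S
  ... | yes y∈S = y∈S
  ... | no  y∉S = contradiction (x , y , x∈S , y∉S , e) ¬exit

  closure : ∀ fuel S → Sound S → u ∈ₛ S → n ≤ fuel + ∣ S ∣ →
            Σ (Subset n) λ S′ → Sound S′ × Closed S′ × u ∈ₛ S′
  closure fuel S sound u∈S bound with exitEdge? S
  ... | no ¬exit = S , sound , no-exitEdge⇒Closed ¬exit , u∈S
  ... | yes (x , y , x∈S , y∉S , e) = grow fuel bound
    where
    S′ = S ∪ ⁅ y ⁆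
    grows : ∣ S ∣ < ∣ S′ ∣
    grows = p⊂q⇒∣p∣<∣q∣ (p⊆p∪q ⁅ y ⁆ , y , x∈p∪q⁺ (inj₂ (x∈⁅x⁆ y)) , y∉S)
    sound′ : Sound S′
    sound′ {z} z∈S′ with x∈p∪q⁻ S ⁅ y ⁆ z∈S′
    ... | inj₁ z∈S = sound z∈S
    ... | inj₂ z∈y = subst (Reach E u) (sym (x∈⁅y⁆⇒x≡y y z∈y)) (Reach-snoc (sound x∈S) e)
    grow : ∀ fuel → n ≤ fuel + ∣ S ∣ → Σ (Subset n) λ S″ → Sound S″ × Closed S″ × u ∈ₛ S″
    grow zero bound = contradiction (≤-trans grows (≤-trans (∣p∣≤n S′) bound)) (<-irrefl refl)
    grow (suc fuel′) bound = closure fuel′ S′ sound′ (p⊆p∪q ⁅ y ⁆ u∈S)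
      (≤-trans bound (subst (_≤ fuel′ + ∣ S′ ∣) (+-suc fuel′ ∣ S ∣) (+-monoʳ-≤ fuel′ grows)))

  Reach? : ∀ v → Dec (Reach E u v)
  Reach? v with closure n ⁅ u ⁆ (λ x∈u → subst (Reach E u) (sym (x∈⁅y⁆⇒x≡y u x∈u)) here)
                  (x∈⁅x⁆ u) (m≤m+n n _)
  ... | S , sound , closed , u∈S with v ∈ₛ? S
  ...   | yes v∈S = yes (sound v∈S)
  ...   | no  v∉S = no λ r → v∉S (Reach-closed (_∈ₛ S) closed u∈S r)

-- Reach-dec and Alt-dec are opaque: unfolding them makes type checking much slower.
opaque
  Reach-dec : ∀ {n} {E : Fin n → Fin n → Set} → (∀ x y → Dec (E x y)) → ∀ u v → Dec (Reach E u v)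
  Reach-dec {E = E} E? = ReachDecidable.Reach? E E?

module _ {A : Set} where

  ⊆-++-split : (xs₁ xs₂ : List A) {ys : List A} → ys ⊆ xs₁ ++ xs₂ →
               ∃₂ λ ys₁ ys₂ → ys ≡ ys₁ ++ ys₂ × ys₁ ⊆ xs₁ × ys₂ ⊆ xs₂
  ⊆-++-split [] xs₂ {ys} σ = [] , ys , refl , [] , σ
  ⊆-++-split (x ∷ xs₁) xs₂ (.x ∷ʳ σ) with ⊆-++-split xs₁ xs₂ σ
  ... | ys₁ , ys₂ , refl , σ₁ , σ₂ = ys₁ , ys₂ , refl , x ∷ʳ σ₁ , σ₂
  ⊆-++-split (x ∷ xs₁) xs₂ (refl ∷ σ) with ⊆-++-split xs₁ xs₂ σ
  ... | ys₁ , ys₂ , refl , σ₁ , σ₂ = x ∷ ys₁ , ys₂ , refl , refl ∷ σ₁ , σ₂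

  Unique-++⁻ʳ : (xs : List A) {ys : List A} → Unique (xs ++ ys) → Unique ys
  Unique-++⁻ʳ [] u = u
  Unique-++⁻ʳ (x ∷ xs) (_ ∷ u) = Unique-++⁻ʳ xs u

  Unique-++⇒disjoint : (xs : List A) {ys : List A} → Unique (xs ++ ys) →
                       ∀ {x y} → x ∈ xs → y ∈ ys → x ≢ y
  Unique-++⇒disjoint (z ∷ xs) u (here refl) y∈ys refl = Unique.Unique[x∷xs]⇒x∉xs u (∈-++⁺ʳ xs y∈ys)
  Unique-++⇒disjoint (z ∷ xs) (_ ∷ u) (there x∈xs) y∈ys = Unique-++⇒disjoint xs u x∈xs y∈ys

  ++-≡-++⁻ : (P Q X Y : List A) → P ++ Q ≡ X ++ Y →
             (∃ λ R → P ≡ X ++ R × Y ≡ R ++ Q) ⊎ (∃ λ M → X ≡ P ++ M × Q ≡ M ++ Y)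
  ++-≡-++⁻ [] Q X Y eq = inj₂ (X , refl , eq)
  ++-≡-++⁻ (p ∷ P) Q [] Y eq = inj₁ (p ∷ P , refl , sym eq)
  ++-≡-++⁻ (p ∷ P) Q (x ∷ X) Y eq with ∷-injective eq
  ... | refl , eq′ with ++-≡-++⁻ P Q X Y eq′
  ...   | inj₁ (R , e₁ , e₂) = inj₁ (R , cong (p ∷_) e₁ , e₂)
  ...   | inj₂ (M , e₁ , e₂) = inj₂ (M , cong (p ∷_) e₁ , e₂)

  filter-≡-++⁻ : ∀ {P : A → Set} (P? : ∀ x → Dec (P x)) L {X Y} → filter P? L ≡ X ++ Y →
                 ∃₂ λ L₁ L₂ → L ≡ L₁ ++ L₂ × filter P? L₁ ≡ X × filter P? L₂ ≡ Y
  filter-≡-++⁻ P? [] {X} {Y} eq = [] , [] , refl , sym (++-conicalˡ X Y (sym eq)) , sym (++-conicalʳ X Y (sym eq))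
  filter-≡-++⁻ P? (x ∷ L) {X} {Y} eq with P? x
  ... | no ¬px with filter-≡-++⁻ P? L eq
  ...   | L₁ , L₂ , refl , e₁ , e₂ = x ∷ L₁ , L₂ , refl , trans (filter-reject P? ¬px) e₁ , e₂
  filter-≡-++⁻ P? (x ∷ L) {[]} {Y} eq | yes px = [] , x ∷ L , refl , refl , trans (filter-accept P? px) eq
  filter-≡-++⁻ P? (x ∷ L) {_ ∷ X} {Y} eq | yes px with ∷-injective eq
  ... | refl , eq′ with filter-≡-++⁻ P? L eq′
  ...   | L₁ , L₂ , refl , e₁ , e₂ = x ∷ L₁ , L₂ , refl , trans (filter-accept P? px) (cong (x ∷_) e₁) , e₂

  length-⊆-prefix : ∀ {T left right : List A} → T ⊆ left → length T ≤ length (left ++ right)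
  length-⊆-prefix {left = left} σ =
    ≤-trans (length-mono-≤ σ) (subst (length left ≤_) (sym (length-++ left)) (m≤m+n _ _))

module _ {A B : Set} (f : A → B) where

  ⊆-map⁻ : ∀ {ys} (xs : List A) → ys ⊆ map f xs → ∃ λ xs′ → xs′ ⊆ xs × map f xs′ ≡ ys
  ⊆-map⁻ [] [] = [] , [] , refl
  ⊆-map⁻ (x ∷ xs) (_ ∷ʳ σ) with ⊆-map⁻ xs σ
  ... | xs′ , σ′ , eq = xs′ , x ∷ʳ σ′ , eq
  ⊆-map⁻ (x ∷ xs) (refl ∷ σ) with ⊆-map⁻ xs σ
  ... | xs′ , σ′ , eq = x ∷ xs′ , refl ∷ σ′ , cong (f x ∷_) eq

last-∷ : ∀ {A : Set} {y b : A} l → last l ≡ just b → last (y ∷ l) ≡ just b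
last-∷ (_ ∷ _) eq = eq

last-++ʳ : ∀ {A : Set} (ys : List A) {zs : List A} {b : A} → last zs ≡ just b → last (ys ++ zs) ≡ just b
last-++ʳ [] eq = eq
last-++ʳ (y ∷ ys) eq = last-∷ (ys ++ _) (last-++ʳ ys eq)

module _ {A : Set} (f : A → List A) where

  head-concatMap : ∀ {a} vs → head vs ≡ just a → f a ≡ [ a ] → head (concatMap f vs) ≡ just a
  head-concatMap (a ∷ vs) refl fa≡[a] rewrite fa≡[a] = refl

  last-concatMap : ∀ {b} vs → last vs ≡ just b → f b ≡ [ b ] → last (concatMap f vs) ≡ just b
  last-concatMap (v ∷ []) refl fb≡[b] = cong last (trans (++-identityʳ (f v)) fb≡[b])
  last-concatMap (v ∷ vs@(_ ∷ _)) eq fb≡[b] = last-++ʳ (f v) (last-concatMap vs eq fb≡[b])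

-- concatMap f vs read as the sequence of blocks f v; below, β x names the block containing x.
module _ {A B : Set} (f : A → List B) where

  record BlockCut (vs : List A) (X Y : List B) : Set where
    field
      before after : List A
      v : A
      left right : List B
      vs≡ : vs ≡ before ++ v ∷ after
      fv≡ : f v ≡ left ++ right
      X≡ : X ≡ concatMap f before ++ left
      Y≡ : Y ≡ right ++ concatMap f after

  concatMap-cut : ∀ vs X Y → concatMap f vs ≡ X ++ Y → Y ≡ [] ⊎ BlockCut vs X Y
  concatMap-cut [] X Y eq = inj₁ (++-conicalʳ X Y (sym eq))
  concatMap-cut (v ∷ vs) X Y eq with ++-≡-++⁻ (f v) (concatMap f vs) X Y eq
  ... | inj₁ (R , e₁ , e₂) = inj₂ (record
        { before = [] ; after = vs ; v = v ; left = X ; right = R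
        ; vs≡ = refl ; fv≡ = e₁ ; X≡ = refl ; Y≡ = e₂ })
  ... | inj₂ (M , e₁ , e₂) with concatMap-cut vs M Y e₂
  ...   | inj₁ Y≡[] = inj₁ Y≡[]
  ...   | inj₂ c = inj₂ (record
          { before = v ∷ before ; after = after ; v = c.v ; left = left ; right = right
          ; vs≡ = cong (v ∷_) vs≡ ; fv≡ = fv≡
          ; X≡ = trans e₁ (trans (cong (f v ++_) X≡) (sym (++-assoc (f v) (concatMap f before) left)))
          ; Y≡ = Y≡ })
    where
    module c = BlockCut c
    open c hiding (v)

  module _ (β : B → A) where

    OwnedBy : List A → Set
    OwnedBy vs = ∀ {v x} → v ∈ vs → x ∈ f v → β x ≡ v

    Unique-concatMap : ∀ {vs} → Unique vs → (∀ {v} → v ∈ vs → Unique (f v)) → OwnedBy vs →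
                       Unique (concatMap f vs)
    Unique-concatMap {[]} _ _ _ = []
    Unique-concatMap {v ∷ vs} v∷vs-Unique@(_ ∷ uniq) uniq-f owned =
      Unique.++⁺ (uniq-f (here refl)) (Unique-concatMap uniq (uniq-f ∘ there) (owned ∘ there)) disjoint
      where
      disjoint : ∀ {x} → ¬ (x ∈ f v × x ∈ concatMap f vs)
      disjoint (x∈fv , x∈rest) with find (∈-concatMap⁻ f {xs = vs} x∈rest)
      ... | v′ , v′∈vs , x∈fv′ = Unique.Unique[x∷xs]⇒x∉xs v∷vs-Unique (subst (_∈ vs) (sym v≡v′) v′∈vs)
        where
        v≡v′ = trans (sym (owned (here refl) x∈fv)) (owned (there v′∈vs) x∈fv′)

    ⊆-concatMap⇒map⊆⊎collision : ∀ vs {T} → OwnedBy vs → T ⊆ concatMap f vs →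
      map β T ⊆ vs ⊎ ∃₂ λ r r′ → (r ∷ r′ ∷ []) ⊆ T × β r ≡ β r′
    ⊆-concatMap⇒map⊆⊎collision [] owned [] = inj₁ []
    ⊆-concatMap⇒map⊆⊎collision (v ∷ vs) owned σ with ⊆-++-split (f v) (concatMap f vs) σ
    ... | [] , T₂ , refl , _ , σ₂ with ⊆-concatMap⇒map⊆⊎collision vs (owned ∘ there) σ₂
    ...   | inj₁ ρ = inj₁ (v ∷ʳ ρ)
    ...   | inj₂ collision = inj₂ collision
    ⊆-concatMap⇒map⊆⊎collision (v ∷ vs) owned σ
        | r ∷ [] , T₂ , refl , σ₁ , σ₂ with ⊆-concatMap⇒map⊆⊎collision vs (owned ∘ there) σ₂
    ...   | inj₁ ρ = inj₁ (owned (here refl) (Any-resp-⊆ σ₁ (here refl)) ∷ ρ)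
    ...   | inj₂ (r₁ , r₂ , ρ , eq) = inj₂ (r₁ , r₂ , r ∷ʳ ρ , eq)
    ⊆-concatMap⇒map⊆⊎collision (v ∷ vs) owned σ
        | r ∷ r′ ∷ _ , T₂ , refl , σ₁ , _ =
          inj₂ (r , r′ , ++⁺ʳ T₂ (refl ∷ refl ∷ []⊆-universal _) ,
                trans (owned′ (here refl)) (sym (owned′ (there (here refl)))))
      where
      owned′ : ∀ {x} → x ∈ r ∷ r′ ∷ _ → β x ≡ v
      owned′ x∈ = owned (here refl) (Any-resp-⊆ σ₁ x∈)

xor-rotate : ∀ a p q → a xor (p xor q) ≡ p xor (a xor q)
xor-rotate a p q = begin
  a xor (p xor q)    ≡⟨ sym (xor-assoc a p q) ⟩
  (a xor p) xor q    ≡⟨ cong (_xor q) (xor-comm a p) ⟩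
  (p xor a) xor q    ≡⟨ xor-assoc p a q ⟩
  p xor (a xor q)    ∎

xor-cancel : ∀ a p q → p xor q ≡ (a xor p) xor (a xor q)
xor-cancel a p q = sym (begin
  (a xor p) xor (a xor q)    ≡⟨ xor-assoc a p (a xor q) ⟩
  a xor (p xor (a xor q))    ≡⟨ cong (a xor_) (xor-rotate p a q) ⟩
  a xor (a xor (p xor q))    ≡⟨ sym (xor-assoc a a (p xor q)) ⟩
  (a xor a) xor (p xor q)    ≡⟨ cong (_xor (p xor q)) (xor-same a) ⟩
  p xor q                    ∎)

does-≟-true : ∀ b → does (b ≟ᵇ true) ≡ b
does-≟-true true = refl
does-≟-true false = refl

¬Any≡false⇒≡true : ∀ {A : Set} {f : A → Bool} {xs} → ¬ Any (λ x → f x ≡ false) xs →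
                   ∀ {x} → x ∈ xs → f x ≡ true
¬Any≡false⇒≡true {f = f} ¬any {x} x∈xs with f x in eq
... | true = refl
... | false = contradiction (lose x∈xs eq) ¬any

module _ {A : Set} where

  parity : (A → Bool) → List A → Bool
  parity f [] = false
  parity f (x ∷ xs) = f x xor parity f xs

  parity-cong : ∀ {f g : A → Bool} xs → (∀ {x} → x ∈ xs → f x ≡ g x) → parity f xs ≡ parity g xs
  parity-cong [] f≗g = refl
  parity-cong (x ∷ xs) f≗g = cong₂ _xor_ (f≗g (here refl)) (parity-cong xs (f≗g ∘ there))

  parity-∧ʳ : ∀ (f : A → Bool) b xs → parity (λ x → f x ∧ b) xs ≡ parity f xs ∧ b
  parity-∧ʳ f b [] = refl
  parity-∧ʳ f b (x ∷ xs) =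
    trans (cong ((f x ∧ b) xor_) (parity-∧ʳ f b xs)) (sym (∧-distribʳ-xor b (f x) (parity f xs)))

  Dependent : (List A → Set) → List A → Set
  Dependent Null T = Σ (List A) λ T′ → T′ ⊆ T × 0 < length T′ × Null T′

  symDiff : ∀ {xs ys zs : List A} → xs ⊆ zs → ys ⊆ zs → List A
  symDiff [] [] = []
  symDiff (z ∷ʳ σ) (.z ∷ʳ τ) = symDiff σ τ
  symDiff (z ∷ʳ σ) (refl ∷ τ) = z ∷ symDiff σ τ
  symDiff (refl ∷ σ) (z ∷ʳ τ) = z ∷ symDiff σ τ
  symDiff (refl ∷ σ) (refl ∷ τ) = symDiff σ τ

  symDiff-⊆ : ∀ {xs ys zs : List A} (σ : xs ⊆ zs) (τ : ys ⊆ zs) → symDiff σ τ ⊆ zs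
  symDiff-⊆ [] [] = []
  symDiff-⊆ (z ∷ʳ σ) (.z ∷ʳ τ) = z ∷ʳ symDiff-⊆ σ τ
  symDiff-⊆ (z ∷ʳ σ) (refl ∷ τ) = refl ∷ symDiff-⊆ σ τ
  symDiff-⊆ (refl ∷ σ) (z ∷ʳ τ) = refl ∷ symDiff-⊆ σ τ
  symDiff-⊆ (refl ∷ σ) (refl ∷ τ) = _ ∷ʳ symDiff-⊆ σ τ

  parity-symDiff : ∀ (f : A → Bool) {xs ys zs : List A} (σ : xs ⊆ zs) (τ : ys ⊆ zs) →
                   parity f (symDiff σ τ) ≡ parity f xs xor parity f ys
  parity-symDiff f [] [] = refl
  parity-symDiff f (z ∷ʳ σ) (.z ∷ʳ τ) = parity-symDiff f σ τ
  parity-symDiff f {xs} {_ ∷ ys} (z ∷ʳ σ) (refl ∷ τ) = begin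
    f z xor parity f (symDiff σ τ)            ≡⟨ cong (f z xor_) (parity-symDiff f σ τ) ⟩
    f z xor (parity f xs xor parity f ys)     ≡⟨ xor-rotate (f z) (parity f xs) (parity f ys) ⟩
    parity f xs xor (f z xor parity f ys)     ∎
  parity-symDiff f {_ ∷ xs} {ys} (refl ∷ σ) (z ∷ʳ τ) = begin
    f z xor parity f (symDiff σ τ)            ≡⟨ cong (f z xor_) (parity-symDiff f σ τ) ⟩
    f z xor (parity f xs xor parity f ys)     ≡⟨ sym (xor-assoc (f z) (parity f xs) (parity f ys)) ⟩
    (f z xor parity f xs) xor parity f ys     ∎
  parity-symDiff f {x ∷ xs} {_ ∷ ys} (refl ∷ σ) (refl ∷ τ) = begin
    parity f (symDiff σ τ)                    ≡⟨ parity-symDiff f σ τ ⟩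
    parity f xs xor parity f ys               ≡⟨ xor-cancel (f x) (parity f xs) (parity f ys) ⟩
    (f x xor parity f xs) xor (f x xor parity f ys) ∎

  delete : ∀ {x : A} {xs zs : List A} → (x ∷ xs) ⊆ zs → List A
  delete (z ∷ʳ σ) = z ∷ delete σ
  delete {zs = _ ∷ zs} (refl ∷ σ) = zs

  delete-⊆ : ∀ {x : A} {xs zs : List A} (σ : (x ∷ xs) ⊆ zs) → delete σ ⊆ zs
  delete-⊆ (z ∷ʳ σ) = refl ∷ delete-⊆ σ
  delete-⊆ (refl ∷ σ) = _ ∷ʳ ⊆-refl

  length-delete : ∀ {x : A} {xs zs : List A} (σ : (x ∷ xs) ⊆ zs) → suc (length (delete σ)) ≡ length zs
  length-delete (z ∷ʳ σ) = cong suc (length-delete σ)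
  length-delete (refl ∷ σ) = refl

  symDiff-delete-nonempty : ∀ {x : A} {xs ys zs : List A} (σ : (x ∷ xs) ⊆ zs) (τ : ys ⊆ delete σ) →
                            0 < length (symDiff σ (⊆-trans τ (delete-⊆ σ)))
  symDiff-delete-nonempty (z ∷ʳ σ) (.z ∷ʳ τ) = symDiff-delete-nonempty σ τ
  symDiff-delete-nonempty (z ∷ʳ σ) (refl ∷ τ) = s≤s z≤n
  symDiff-delete-nonempty (refl ∷ σ) τ = s≤s z≤n

module _ {A B : Set} (f : A → B) where

  parity-map : ∀ (g : B → Bool) xs → parity g (map f xs) ≡ parity (g ∘ f) xs
  parity-map g [] = refl
  parity-map g (x ∷ xs) = cong (g (f x) xor_) (parity-map g xs)

module _ {A I : Set} (entry : I → A → Bool) (Col : I → Set) where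

  ZeroOn : List A → Set
  ZeroOn U = ∀ c → Col c → parity (entry c) U ≡ false

  -- Adding one column raises the rank by at most one: if the first dependency fails on the new
  -- column h, a second one avoiding an element of the first is found, and their symmetric
  -- difference works.
  Dependent-addColumn : (h : A → Bool) {k : ℕ} {T : List A} →
    (∀ {U} → U ⊆ T → k < length U → Dependent ZeroOn U) → suc k < length T →
    Dependent (λ U → ZeroOn U × parity h U ≡ false) T
  Dependent-addColumn h {k} {T} dep k+1<T with dep ⊆-refl (≤-trans (n≤1+n _) k+1<T)
  ... | [] , _ , () , _
  ... | S@(_ ∷ _) , σ , S≢[] , zeroS with parity h S in hS
  ...   | false = S , σ , S≢[] , zeroS , hS
  ...   | true with dep (delete-⊆ σ) (≤-pred (subst (suc (suc k) ≤_) (sym (length-delete σ)) k+1<T))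
  ...     | S′ , σ′ , S′≢[] , zeroS′ with parity h S′ in hS′
  ...       | false = S′ , ⊆-trans σ′ (delete-⊆ σ) , S′≢[] , zeroS′ , hS′
  ...       | true = symDiff σ τ , symDiff-⊆ σ τ , symDiff-delete-nonempty σ σ′ ,
                     (λ c col → trans (parity-symDiff (entry c) σ τ) (cong₂ _xor_ (zeroS c col) (zeroS′ c col))) ,
                     trans (parity-symDiff h σ τ) (cong₂ _xor_ hS hS′)
    where
    τ = ⊆-trans σ′ (delete-⊆ σ)

module _ {n : ℕ} {P : Fin n → Set} (P? : ∀ x → Dec (P x)) where

  Parity-parity : ∀ xs → Parity P xs (parity (λ x → does (P? x)) xs)
  Parity-parity [] = nil
  Parity-parity (x ∷ xs) with P? x
  ... | yes px = Parity.yes px (Parity-parity xs)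
  ... | no ¬px = Parity.no ¬px (Parity-parity xs)

  Parity⇒≡parity : ∀ {xs b} → Parity P xs b → b ≡ parity (λ x → does (P? x)) xs
  Parity⇒≡parity nil = refl
  Parity⇒≡parity (Parity.yes {x} px r) with P? x
  ... | yes _ = cong not (Parity⇒≡parity r)
  ... | no ¬px = contradiction px ¬px
  Parity⇒≡parity (Parity.no {x} ¬px r) with P? x
  ... | yes px = contradiction px ¬px
  ... | no _ = Parity⇒≡parity r

Parity⇒≡parityᵇ : ∀ {n} {f : Fin n → Bool} {xs b} → Parity (λ x → f x ≡ true) xs b → b ≡ parity f xs
Parity⇒≡parityᵇ {f = f} {xs} par =
  trans (Parity⇒≡parity (λ x → f x ≟ᵇ true) par) (parity-cong xs λ {x} _ → does-≟-true (f x))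

cut-length-split : ∀ {p k t₁ t₂} → p + suc k < t₁ + t₂ → ¬ (p < t₁) → suc k < t₂
cut-length-split lt p≮t₁ = ≰⇒> λ t₂≤ → <⇒≱ lt (+-mono-≤ (≮⇒≥ p≮t₁) t₂≤)

WidthAtMost-mono : ∀ {n} {G : SubGraph n} {L w w′} → w ≤ w′ → WidthAtMost G L w → WidthAtMost G L w′
WidthAtMost-mono w≤w′ width X Y eq T σ w′<T = width X Y eq T σ (≤-<-trans w≤w′ w′<T)

p+1+k≤2p+k : ∀ {p} k → 1 ≤ p → p + suc k ≤ 2 * p + k
p+1+k≤2p+k {p} k 1≤p = subst (p + suc k ≤_) p+[p+k]≡2p+k (+-monoʳ-≤ p (+-monoˡ-≤ k 1≤p))
  where
  p+[p+k]≡2p+k : p + (p + k) ≡ 2 * p + k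
  p+[p+k]≡2p+k = begin
    p + (p + k)    ≡⟨ sym (+-assoc p p k) ⟩
    (p + p) + k    ≡⟨ cong (λ q → (p + q) + k) (sym (+-identityʳ p)) ⟩
    2 * p + k      ∎

module _ {n : ℕ} (D : MarkedGraph n) where

  UEdge-sym : ∀ {x y} → UEdge D x y → UEdge D y x
  UEdge-sym {x} {y} (e , m) = trans (adj-sym D y x) e , trans (mk-sym D y x) m

  UEdge? : ∀ x y → Dec (UEdge D x y)
  UEdge? x y = (adj D x y ≟ᵇ true) ×-dec (mk D x y ≟ᵇ false)

  SameBag? : ∀ u v → Dec (SameBag D u v)
  SameBag? = Reach-dec UEdge?

  SameBag-sym : ∀ {u v} → SameBag D u v → SameBag D v u
  SameBag-sym = Reach-sym UEdge-sym

  mk-matchingˡ : ∀ {u u′ w} → mk D u w ≡ true → mk D u′ w ≡ true → u ≡ u′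
  mk-matchingˡ {u} {u′} {w} m m′ =
    mk-matching D w u u′ (trans (mk-sym D w u) m) (trans (mk-sym D w u′) m′)

  adj⇒≢ : ∀ {u v} → adj D u v ≡ true → u ≢ v
  adj⇒≢ {u} e refl = contradiction (trans (sym e) (adj-irrefl D u)) λ ()

  UEdge⇒NotEdge : ∀ {u w x y} → mk D u w ≡ true → UEdge D x y → adj D x y ≡ true × NotEdge u w x y
  UEdge⇒NotEdge {u} {w} m (e , m′) = e , λ where
    (inj₁ (refl , refl)) → contradiction (trans (sym m) m′) λ ()
    (inj₂ (refl , refl)) → contradiction (trans (sym m) (trans (mk-sym D u w) m′)) λ ()

  marked⇒¬SameBag : ∀ {u w} → mk D u w ≡ true → ¬ SameBag D u w
  marked⇒¬SameBag {u} {w} m r = mk-cut D u w m (Reach-map (UEdge⇒NotEdge m) r)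

  leaving-bag⇒marked : ∀ {a x y} → SameBag D a x → adj D x y ≡ true → ¬ SameBag D a y → mk D x y ≡ true
  leaving-bag⇒marked {a} {x} {y} ax e ¬ay with mk D x y in eq
  ... | true = refl
  ... | false = contradiction (Reach-snoc ax (e , eq)) ¬ay

  Alt-length : ∀ {S u v} → Alt D S u v → ℕ
  Alt-length (one _ _ _) = zero
  Alt-length (more _ _ _ _ _ p) = suc (Alt-length p)

  module _ {S : Fin n → Set} where

    Alt-source : ∀ {u v} → Alt D S u v → S u
    Alt-source (one su _ _) = su
    Alt-source (more su _ _ _ _ _) = su

    Alt-target : ∀ {u v} → Alt D S u v → S v
    Alt-target (one _ sv _) = sv
    Alt-target (more _ _ _ _ _ p) = Alt-target p

    Alt-mono : ∀ {S′ : Fin n → Set} → (∀ {x} → S x → S′ x) → ∀ {u v} → Alt D S u v → Alt D S′ u v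
    Alt-mono f (one su sv e) = one (f su) (f sv) e
    Alt-mono f (more su sw sw′ e m p) = more (f su) (f sw) (f sw′) e m (Alt-mono f p)

    Alt-length-mono : ∀ {S′ : Fin n → Set} (f : ∀ {x} → S x → S′ x) {u v} (p : Alt D S u v) →
                      Alt-length (Alt-mono f p) ≡ Alt-length p
    Alt-length-mono f (one _ _ _) = refl
    Alt-length-mono f (more _ _ _ _ _ p) = cong suc (Alt-length-mono f p)

    Alt-++ : ∀ {x w v y} → Alt D S x w → mk D w v ≡ true → S v → Alt D S v y → Alt D S x y
    Alt-++ (one sx sw e) m sv q = more sx sw sv e m q
    Alt-++ (more sx sw sw′ e m p) m′ sv q = more sx sw sw′ e m (Alt-++ p m′ sv q)

    Alt-reverse : ∀ {u v} → Alt D S u v → Alt D S v u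
    Alt-reverse (one su sv e) = one sv su (UEdge-sym e)
    Alt-reverse (more {w = w} {w′} su sw sw′ e m p) =
      Alt-++ (Alt-reverse p) (trans (mk-sym D w′ w) m) sw (one sw su (UEdge-sym e))

  -- An alternating walk is a walk of "unmarked edge, then marked edge" steps followed by one
  -- unmarked edge, so deciding it reduces to reachability.
  module AltDecidable (S : Fin n → Set) (S? : ∀ x → Dec (S x)) where

    AltStep : Fin n → Fin n → Set
    AltStep u w′ = S u × ∃ λ w → S w × S w′ × UEdge D u w × mk D w w′ ≡ true

    AltStep? : ∀ u w′ → Dec (AltStep u w′)
    AltStep? u w′ = S? u ×-dec any? λ w → S? w ×-dec S? w′ ×-dec UEdge? u w ×-dec (mk D w w′ ≟ᵇ true)

    AltViaSteps : Fin n → Fin n → Set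
    AltViaSteps u v = ∃ λ t → Reach AltStep u t × S t × S v × UEdge D t v

    toSteps : ∀ {u v} → Alt D S u v → AltViaSteps u v
    toSteps {u} (one su sv e) = u , here , su , sv , e
    toSteps (more su sw sw′ e m p) with toSteps p
    ... | t , r , st , sv , e′ = t , step (su , _ , sw , sw′ , e , m) r , st , sv , e′

    fromSteps : ∀ {u v} → AltViaSteps u v → Alt D S u v
    fromSteps (_ , here , st , sv , e) = one st sv e
    fromSteps (t , step (su , _ , sw , sw′ , e , m) r , st , sv , e′) =
      more su sw sw′ e m (fromSteps (t , r , st , sv , e′))

    Alt? : ∀ u v → Dec (Alt D S u v)
    Alt? u v = map′ fromSteps toSteps
      (any? λ t → Reach-dec AltStep? u t ×-dec S? t ×-dec S? v ×-dec UEdge? t v)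

  opaque
    Alt-dec : (S : Fin n → Set) → (∀ x → Dec (S x)) → ∀ u v → Dec (Alt D S u v)
    Alt-dec = AltDecidable.Alt?

  AltWalk : Fin n → Fin n → Set
  AltWalk = Alt D (λ _ → ⊤)

  module Components (a : Fin n) where

    InBag : Fin n → Set
    InBag = SameBag D a

    CompEdge : Fin n → Fin n → Set
    CompEdge x y = adj D x y ≡ true × ¬ InBag x × ¬ InBag y

    Comp? : ∀ w x → Dec (Comp D a w x)
    Comp? = Reach-dec λ x y → (adj D x y ≟ᵇ true) ×-dec ¬? (SameBag? a x) ×-dec ¬? (SameBag? a y)

    Comp-sym : ∀ {w x} → Comp D a w x → Comp D a x w
    Comp-sym = Reach-sym λ {x} {y} (e , x∉B , y∉B) → trans (adj-sym D y x) e , y∉B , x∉B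

    partner∉bag : ∀ {v w} → InBag v → mk D v w ≡ true → ¬ InBag w
    partner∉bag v∈B m w∈B = marked⇒¬SameBag m (Reach-trans (SameBag-sym v∈B) w∈B)

    Comp⇒∉bag : ∀ {w x} → ¬ InBag w → Comp D a w x → ¬ InBag x
    Comp⇒∉bag w∉B here = w∉B
    Comp⇒∉bag w∉B (step (_ , _ , y∉B) r) = Comp⇒∉bag y∉B r

    Comp-snoc : ∀ {w x y} → ¬ InBag w → Comp D a w x → adj D x y ≡ true → ¬ InBag y → Comp D a w y
    Comp-snoc w∉B c e y∉B = Reach-snoc c (e , Comp⇒∉bag w∉B c , y∉B)

    -- Two marked edges vw, v′w′ leaving B into the same component would give a walk from v
    -- to w avoiding the cut-edge vw.
    attachment-unique : ∀ {v w v′ w′ y} → InBag v → mk D v w ≡ true → InBag v′ → mk D v′ w′ ≡ true →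
                        Comp D a w y → Comp D a w′ y → w ≡ w′
    attachment-unique {v} {w} {v′} {w′} v∈B m v′∈B m′ c c′ with w ≟ᶠ w′
    ... | yes w≡w′ = w≡w′
    ... | no w≢w′ = contradiction
          (Reach-trans (Reach-map (UEdge⇒NotEdge m) (Reach-trans (SameBag-sym v∈B) v′∈B))
            (step (mk⊆adj D v′ w′ m′ , v′w′≠vw) (Reach-map avoid (Reach-trans c′ (Comp-sym c)))))
          (mk-cut D v w m)
      where
      v′w′≠vw : NotEdge v w v′ w′
      v′w′≠vw (inj₁ (_ , w′≡w)) = w≢w′ (sym w′≡w)
      v′w′≠vw (inj₂ (v′≡w , _)) = partner∉bag v∈B m (subst InBag v′≡w v′∈B)
      avoid : ∀ {x y} → CompEdge x y → adj D x y ≡ true × NotEdge v w x y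
      avoid (e , x∉B , y∉B) = e , λ where
        (inj₁ (refl , _)) → x∉B v∈B
        (inj₂ (_ , refl)) → y∉B v∈B

    Block : Fin n → Fin n → Set
    Block v x = InBag v × (x ≡ v ⊎ ∃ λ w → mk D v w ≡ true × Comp D a w x)

    Block-unique : ∀ {v v′ x} → Block v x → Block v′ x → v ≡ v′
    Block-unique (_ , inj₁ refl) (_ , inj₁ refl) = refl
    Block-unique (v∈B , inj₁ refl) (v′∈B , inj₂ (_ , m′ , c′)) =
      contradiction v∈B (Comp⇒∉bag (partner∉bag v′∈B m′) c′)
    Block-unique (v∈B , inj₂ (_ , m , c)) (v′∈B , inj₁ refl) =
      contradiction v′∈B (Comp⇒∉bag (partner∉bag v∈B m) c)
    Block-unique (v∈B , inj₂ (w , m , c)) (v′∈B , inj₂ (w′ , m′ , c′))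
      with attachment-unique v∈B m v′∈B m′ c c′
    ... | refl = mk-matchingˡ m m′

    HangsOffBag : Fin n → Set
    HangsOffBag x = ∃₂ λ v w → InBag v × mk D v w ≡ true × Comp D a w x

    -- Along a walk from B, the last vertex of B before x is joined to the component of x by a
    -- marked edge.
    walk⇒HangsOffBag : ∀ {s x} → Reach (λ p q → adj D p q ≡ true) s x → InBag s ⊎ HangsOffBag s →
                       ¬ InBag x → HangsOffBag x
    walk⇒HangsOffBag here (inj₁ s∈B) x∉B = contradiction s∈B x∉B
    walk⇒HangsOffBag here (inj₂ h) x∉B = h
    walk⇒HangsOffBag {s} (step {v = t} e r) s-ok x∉B with SameBag? a t
    ... | yes t∈B = walk⇒HangsOffBag r (inj₁ t∈B) x∉B
    ... | no t∉B with s-ok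
    ...   | inj₁ s∈B = walk⇒HangsOffBag r (inj₂ (s , t , s∈B , leaving-bag⇒marked s∈B e t∉B , here)) x∉B
    ...   | inj₂ (v , w , v∈B , m , c) =
              walk⇒HangsOffBag r (inj₂ (v , w , v∈B , m , Comp-snoc (partner∉bag v∈B m) c e t∉B)) x∉B

    Block-cover : ∀ x → ∃ λ v → Block v x
    Block-cover x with SameBag? a x
    ... | yes x∈B = x , x∈B , inj₁ refl
    ... | no x∉B with walk⇒HangsOffBag (connected D a x) (inj₁ here) x∉B
    ...   | v , w , v∈B , m , c = v , v∈B , inj₂ (w , m , c)

    Unmarked-in-component : ∀ {v w x} → InBag v → mk D v w ≡ true → Comp D a w x → x ≢ w →
                            (∀ y → Comp D a w y → mk D x y ≡ false) → Unmarked D x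
    Unmarked-in-component {v} {w} {x} v∈B m c x≢w unmarked-in-Dᵢ y with mk D x y in eq
    ... | false = refl
    ... | true with SameBag? a y
    ...   | no y∉B = contradiction
              (trans (sym eq) (unmarked-in-Dᵢ y (Comp-snoc (partner∉bag v∈B m) c (mk⊆adj D x y eq) y∉B)))
              λ ()
    ...   | yes y∈B = contradiction (sym (attachment-unique v∈B m y∈B (trans (mk-sym D y x) eq) c here)) x≢w

    UEdge-within-component : ∀ {v w x y} → InBag v → mk D v w ≡ true → Comp D a w x → UEdge D x y →
                             Comp D a w y
    UEdge-within-component {v} {w} {x} {y} v∈B m c (e , unmarked) with SameBag? a y
    ... | no y∉B = Comp-snoc (partner∉bag v∈B m) c e y∉B
    ... | yes y∈B = contradiction (trans (sym marked) unmarked) λ ()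
      where
      marked : mk D x y ≡ true
      marked = trans (mk-sym D x y)
        (leaving-bag⇒marked y∈B (trans (adj-sym D y x) e) (Comp⇒∉bag (partner∉bag v∈B m) c))

    Alt-leave-component : ∀ {v w} → InBag v → mk D v w ≡ true →
                          ∀ {x y} → Comp D a w x → (p : AltWalk x y) →
      Alt D (Comp D a w) x y ⊎ Σ (Alt D (Comp D a w) x w) λ q → Alt-length q ≤ Alt-length p × AltWalk v y
    Alt-leave-component v∈B m c (one _ _ e) = inj₁ (one c (UEdge-within-component v∈B m c e) e)
    Alt-leave-component {v} {w} v∈B m c (more {w = u} {u′} _ _ _ e m′ p)
      with UEdge-within-component v∈B m c e | SameBag? a u′
    ... | cu | no u′∉B
      with Alt-leave-component v∈B m (Comp-snoc (partner∉bag v∈B m) cu (mk⊆adj D u u′ m′) u′∉B) p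
    ...   | inj₁ q = inj₁ (more c cu (Alt-source q) e m′ q)
    ...   | inj₂ (q , q≤p , r) = inj₂ (more c cu (Alt-source q) e m′ q , s≤s q≤p , r)
    Alt-leave-component {v} {w} v∈B m c (more {w = u} {u′} _ _ _ e m′ p)
        | cu | yes u′∈B with attachment-unique u′∈B (trans (mk-sym D u′ u) m′) v∈B m here cu
    ... | refl with mk-matchingˡ (trans (mk-sym D u′ u) m′) m
    ...   | refl = inj₂ (one c here e , z≤n , p)

  -- A closed alternating walk through a marked edge zz′ has to come back across it, which leaves a
  -- shorter closed alternating walk inside the component of z′.
  AltWalk-irrefl : ∀ {u} → ¬ AltWalk u u
  AltWalk-irrefl l = shorter (Alt-length l) l ≤-refl
    where
    shorter : ∀ bound {u} (l : AltWalk u u) → Alt-length l ≤ bound → ⊥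
    shorter _ (one _ _ e) _ = adj⇒≢ (proj₁ e) refl
    shorter zero (more _ _ _ _ _ _) ()
    shorter (suc bound) {u} (more _ _ _ e m r) (s≤s r≤bound)
      with Components.Alt-leave-component u (step e here) m here r
    ... | inj₁ q = Components.Comp⇒∉bag u (Components.partner∉bag u (step e here) m) (Alt-target q) here
    ... | inj₂ (q , q≤r , _) = shorter bound (Alt-mono _ q)
            (≤-trans (≤-reflexive (Alt-length-mono _ q)) (≤-trans q≤r r≤bound))

  module Blocks (a : Fin n) where
    open Components a

    -- x represents the bag vertex v in D̂: x is v itself, or x is adjacent, in the hat graph of the
    -- component hanging off v, to the end w of the marked edge vw.
    Linked : Fin n → Fin n → Set
    Linked v x = x ≡ v ⊎ ∃ λ w → mk D v w ≡ true × Alt D (Comp D a w) x w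

    AltWalk-from-bag : ∀ {v v′ c} → InBag v → AltWalk v c → Block v′ c → adj D v v′ ≡ true × Linked v′ c
    AltWalk-from-bag v∈B (one _ _ e) (_ , inj₁ refl) = proj₁ e , inj₁ refl
    AltWalk-from-bag v∈B (one _ _ e) (v′∈B , inj₂ (w′ , m′ , c′)) =
      contradiction (Reach-snoc v∈B e) (Comp⇒∉bag (partner∉bag v′∈B m′) c′)
    AltWalk-from-bag v∈B (more {w = z} {z′} _ _ _ e m r) c∈v′ with Alt-leave-component (Reach-snoc v∈B e) m here r
    ... | inj₂ (q , _ , _) = contradiction (Alt-mono _ q) AltWalk-irrefl
    ... | inj₁ q with Block-unique (Reach-snoc v∈B e , inj₂ (z′ , m , Alt-target q)) c∈v′
    ...   | refl = proj₁ e , inj₂ (z′ , m , Alt-reverse q)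

    AltWalk-between-blocks⁻ : ∀ {v v′ x c} → v ≢ v′ → Block v x → Block v′ c → AltWalk x c →
                              adj D v v′ ≡ true × Linked v x × Linked v′ c
    AltWalk-between-blocks⁻ v≢v′ (v∈B , inj₁ refl) c∈v′ p with AltWalk-from-bag v∈B p c∈v′
    ... | e , linked = e , inj₁ refl , linked
    AltWalk-between-blocks⁻ v≢v′ (v∈B , inj₂ (w , m , cx)) c∈v′ p with Alt-leave-component v∈B m cx p
    ... | inj₁ q = contradiction (Block-unique (v∈B , inj₂ (w , m , Alt-target q)) c∈v′) v≢v′
    ... | inj₂ (q , _ , r) with AltWalk-from-bag v∈B r c∈v′
    ...   | e , linked = e , inj₂ (w , m , q) , linked

    AltWalk-between-blocks⁺ : ∀ {v v′ x c} → InBag v → InBag v′ → adj D v v′ ≡ true →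
                              Linked v x → Linked v′ c → AltWalk x c
    AltWalk-between-blocks⁺ {v} {v′} {x} {c} v∈B v′∈B e x~v c~v′ = from-x x~v (to-c c~v′)
      where
      unmarked : mk D v v′ ≡ false
      unmarked with mk D v v′ in eq
      ... | false = refl
      ... | true = contradiction (Reach-trans (SameBag-sym v∈B) v′∈B) (marked⇒¬SameBag eq)
      to-c : ∀ {c} → Linked v′ c → AltWalk v c
      to-c (inj₁ refl) = one tt tt (e , unmarked)
      to-c (inj₂ (w′ , m′ , q′)) = more tt tt tt (e , unmarked) m′ (Alt-mono _ (Alt-reverse q′))
      from-x : ∀ {x} → Linked v x → AltWalk v c → AltWalk x c
      from-x (inj₁ refl) p = p
      from-x (inj₂ (w , m , q)) p = Alt-++ (Alt-mono _ q) (trans (mk-sym D w v) m) tt p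

    AltWalk-within-component : ∀ {v w x c} → InBag v → mk D v w ≡ true → Comp D a w x → Comp D a w c →
                               AltWalk x c → Alt D (Comp D a w) x c
    AltWalk-within-component v∈B m cx cc p with Alt-leave-component v∈B m cx p
    ... | inj₁ q = q
    ... | inj₂ (q , _ , r) =
      contradiction refl (adj⇒≢ (proj₁ (AltWalk-from-bag v∈B r (v∈B , inj₂ (_ , m , cc)))))

  CompLayouts : Fin n → ℕ → Set
  CompLayouts a k = ∀ r → ¬ SameBag D a r → LrwAtMost (hat D (Comp D a r)) k

  module BlockLists (a : Fin n) {k : ℕ} (comp-layouts : CompLayouts a k) where
    open Components a
    open Blocks a

    compLayout : ∀ w → ¬ InBag w → List (Fin n)
    compLayout w w∉B = proj₁ (comp-layouts w w∉B)

    compLayout-isLayout : ∀ w (w∉B : ¬ InBag w) → Layout (hat D (Comp D a w)) (compLayout w w∉B)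
    compLayout-isLayout w w∉B = proj₁ (proj₂ (comp-layouts w w∉B))

    compLayout-width : ∀ w (w∉B : ¬ InBag w) → WidthAtMost (hat D (Comp D a w)) (compLayout w w∉B) k
    compLayout-width w w∉B = proj₂ (proj₂ (comp-layouts w w∉B))

    partner? : ∀ v → Dec (∃ λ w → mk D v w ≡ true)
    partner? v = any? λ w → mk D v w ≟ᵇ true

    ≢? : (w x : Fin n) → Dec (x ≢ w)
    ≢? w x = ¬? (x ≟ᶠ w)

    -- The end w of the marked edge is a vertex of the hat graph of its component but not of D̂.
    -- The value [] arises only for v ∉ B.
    block : Fin n → List (Fin n)
    block v with partner? v
    ... | no _ = [ v ]
    ... | yes (w , _) with SameBag? a w
    ...   | yes _ = []
    ...   | no w∉B = filter (≢? w) (compLayout w w∉B)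

    block-sound : ∀ {v x} → InBag v → x ∈ block v → Unmarked D x × Block v x
    block-sound {v} v∈B x∈ with partner? v
    block-sound {v} v∈B (here refl) | no no-partner = unmarked , v∈B , inj₁ refl
      where
      unmarked : Unmarked D v
      unmarked u with mk D v u in eq
      ... | true = contradiction (u , eq) no-partner
      ... | false = refl
    block-sound {v} v∈B x∈ | yes (w , m) with SameBag? a w
    block-sound {v} v∈B () | yes (w , m) | yes _
    block-sound {v} {x} v∈B x∈ | yes (w , m) | no w∉B =
      Unmarked-in-component v∈B m cx x≢w unmarked-in-Dᵢ , v∈B , inj₂ (w , m , cx)
      where
      x∈L×x≢w = ∈-filter⁻ (≢? w) {xs = compLayout w w∉B} x∈
      x≢w = proj₂ x∈L×x≢w
      vertex = proj₁ (proj₂ (compLayout-isLayout w w∉B)) x (proj₁ x∈L×x≢w)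
      cx = proj₁ vertex
      unmarked-in-Dᵢ = proj₂ vertex

    block-complete : ∀ {v x} → InBag v → Unmarked D x → Block v x → x ∈ block v
    block-complete {v} v∈B unmarked x∈v with partner? v
    block-complete v∈B unmarked (_ , inj₁ refl) | no _ = here refl
    block-complete v∈B unmarked (_ , inj₂ (w , m , _)) | no no-partner = contradiction (w , m) no-partner
    block-complete v∈B unmarked (_ , inj₁ refl) | yes (w , m) = contradiction (trans (sym m) (unmarked w)) λ ()
    block-complete {v} {x} v∈B unmarked (_ , inj₂ (w′ , m′ , cx)) | yes (w , m) with mk-matching D v w w′ m m′
    ... | refl with SameBag? a w
    ...   | yes w∈B = contradiction w∈B (partner∉bag v∈B m)
    ...   | no w∉B =
      ∈-filter⁺ (≢? w) (proj₂ (proj₂ (compLayout-isLayout w w∉B)) x (cx , λ u _ → unmarked u)) x≢w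
      where
      x≢w : x ≢ w
      x≢w refl = contradiction (trans (sym (trans (mk-sym D x v) m)) (unmarked v)) λ ()

    block-Unique : ∀ v → Unique (block v)
    block-Unique v with partner? v
    ... | no _ = [] ∷ []
    ... | yes (w , _) with SameBag? a w
    ...   | yes _ = []
    ...   | no w∉B = Unique.filter⁺ (≢? w) (proj₁ (compLayout-isLayout w w∉B))

    block-unmarked : ∀ {v} → Unmarked D v → block v ≡ [ v ]
    block-unmarked {v} unmarked with partner? v
    ... | no _ = refl
    ... | yes (w , m) = contradiction (trans (sym m) (unmarked w)) λ ()

    blockOf : Fin n → Fin n
    blockOf x = proj₁ (Block-cover x)

    blockOf-Block : ∀ {v x} → Block v x → blockOf x ≡ v
    blockOf-Block = Block-unique (proj₂ (Block-cover _))

    altWalk? : ∀ x y → Dec (AltWalk x y)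
    altWalk? = Alt-dec (λ _ → ⊤) (λ _ → yes tt)

    altIn? : ∀ w x y → Dec (Alt D (Comp D a w) x y)
    altIn? w = Alt-dec (Comp D a w) (Comp? w)

    Linked? : ∀ v x → Dec (Linked v x)
    Linked? v x = (x ≟ᶠ v) ⊎-dec any? λ w → (mk D v w ≟ᵇ true) ×-dec altIn? w x w

    edge linked : Fin n → Fin n → Bool
    edge x y = does (altWalk? x y)
    linked v x = does (Linked? v x)

    compEdge : Fin n → Fin n → Fin n → Bool
    compEdge w x y = does (altIn? w x y)

    edge-between-blocks : ∀ {v v′ x c} → InBag v → InBag v′ → v ≢ v′ → Block v x → Block v′ c →
                          edge x c ≡ linked v x ∧ (adj D v v′ ∧ linked v′ c)
    edge-between-blocks {v} {v′} {x} {c} v∈B v′∈B v≢v′ x∈v c∈v′ = begin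
      edge x c
        ≡⟨ does-⇔ (mk⇔ to from) (altWalk? x c) product? ⟩
      linked v x ∧ (does (adj D v v′ ≟ᵇ true) ∧ linked v′ c)
        ≡⟨ cong (λ b → linked v x ∧ (b ∧ linked v′ c)) (does-≟-true _) ⟩
      linked v x ∧ (adj D v v′ ∧ linked v′ c)
        ∎
      where
      product? = Linked? v x ×-dec ((adj D v v′ ≟ᵇ true) ×-dec Linked? v′ c)
      to : AltWalk x c → Linked v x × adj D v v′ ≡ true × Linked v′ c
      to p with AltWalk-between-blocks⁻ v≢v′ x∈v c∈v′ p
      ... | e , x~v , c~v′ = x~v , e , c~v′
      from : Linked v x × adj D v v′ ≡ true × Linked v′ c → AltWalk x c
      from (x~v , e , c~v′) = AltWalk-between-blocks⁺ v∈B v′∈B e x~v c~v′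

    edge-within-component : ∀ {v w x c} → InBag v → mk D v w ≡ true → Comp D a w x → Comp D a w c →
                            edge x c ≡ compEdge w x c
    edge-within-component {v} {w} {x} {c} v∈B m cx cc =
      does-⇔ (mk⇔ (AltWalk-within-component v∈B m cx cc) (Alt-mono _)) (altWalk? x c) (altIn? w x c)

    linked-in-component : ∀ {v w x} → InBag v → mk D v w ≡ true → Comp D a w x → linked v x ≡ compEdge w x w
    linked-in-component {v} {w} {x} v∈B m cx =
      does-⇔ (mk⇔ to (λ q → inj₂ (w , m , q))) (Linked? v x) (altIn? w x w)
      where
      to : Linked v x → Alt D (Comp D a w) x w
      to (inj₁ refl) = contradiction v∈B (Comp⇒∉bag (partner∉bag v∈B m) cx)
      to (inj₂ (w′ , m′ , q)) with mk-matching D v w w′ m m′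
      ... | refl = q

    OwnedBy-blocks : ∀ {vs} → (∀ {v} → v ∈ vs → InBag v) → OwnedBy block blockOf vs
    OwnedBy-blocks vs⊆B v∈vs x∈v = blockOf-Block (proj₂ (block-sound (vs⊆B v∈vs) x∈v))

    ZeroOnBlocksOf : List (Fin n) → List (Fin n) → Set
    ZeroOnBlocksOf cols T = ∀ {v′ c} → v′ ∈ cols → Block v′ c → parity (λ r → edge r c) T ≡ false

    -- Against columns in the blocks of cols, a row r is zero if r is not linked to blockOf r, and
    -- is the row of blockOf r in B otherwise; so these rows have rank at most the cut-rank in B.
    module RowsOfBlocks {rows cols : List (Fin n)} (rows⊆B : ∀ {v} → v ∈ rows → InBag v)
                        (disjoint : ∀ {v v′} → v ∈ rows → v′ ∈ cols → v ≢ v′)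
                        {T : List (Fin n)} (σ : T ⊆ concatMap block rows) where

      blockOf-row : ∀ {r} → r ∈ T → blockOf r ∈ rows
      blockOf-row r∈T with find (∈-concatMap⁻ block {xs = rows} (Any-resp-⊆ σ r∈T))
      ... | v , v∈rows , r∈v = subst (_∈ rows) (sym (OwnedBy-blocks rows⊆B v∈rows r∈v)) v∈rows

      row-formula : ∀ {r v′ c} → r ∈ T → v′ ∈ cols → Block v′ c →
                    edge r c ≡ linked (blockOf r) r ∧ (adj D (blockOf r) v′ ∧ linked v′ c)
      row-formula {r} r∈T v′∈ c∈v′ = edge-between-blocks (proj₁ r∈β) (proj₁ c∈v′)
        (disjoint (blockOf-row r∈T) v′∈) r∈β c∈v′
        where
        r∈β = proj₂ (Block-cover r)

      zero-row : ∀ {r} → r ∈ T → linked (blockOf r) r ≡ false → Dependent (ZeroOnBlocksOf cols) T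
      zero-row {r} r∈T unlinked = [ r ] , from∈ r∈T , s≤s z≤n , λ {v′} {c} v′∈ c∈v′ →
        cong (_xor false)
          (trans (row-formula r∈T v′∈ c∈v′) (cong (_∧ (adj D (blockOf r) v′ ∧ linked v′ c)) unlinked))

      module _ (all-linked : ∀ {r} → r ∈ T → linked (blockOf r) r ≡ true) where

        linked-row : ∀ {r v′ c} → r ∈ T → v′ ∈ cols → Block v′ c →
                     edge r c ≡ adj D (blockOf r) v′ ∧ linked v′ c
        linked-row {r} {v′} {c} r∈T v′∈ c∈v′ =
          trans (row-formula r∈T v′∈ c∈v′) (cong (_∧ (adj D (blockOf r) v′ ∧ linked v′ c)) (all-linked r∈T))

        repeated-row : ∀ {r r′} → (r ∷ r′ ∷ []) ⊆ T → blockOf r ≡ blockOf r′ →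
                       Dependent (ZeroOnBlocksOf cols) T
        repeated-row {r} {r′} ρ same-block = r ∷ r′ ∷ [] , ρ , s≤s z≤n , λ {v′} {c} v′∈ c∈v′ → begin
          edge r c xor (edge r′ c xor false)   ≡⟨ cong (edge r c xor_) (xor-identityʳ (edge r′ c)) ⟩
          edge r c xor edge r′ c               ≡⟨ cong (edge r c xor_) (sym (same-row v′∈ c∈v′)) ⟩
          edge r c xor edge r c                ≡⟨ xor-same (edge r c) ⟩
          false                                ∎
          where
          same-row : ∀ {v′ c} → v′ ∈ cols → Block v′ c → edge r c ≡ edge r′ c
          same-row v′∈ c∈v′ = trans (linked-row (Any-resp-⊆ ρ (here refl)) v′∈ c∈v′)
            (trans (cong (λ u → adj D u _ ∧ _) same-block)
                   (sym (linked-row (Any-resp-⊆ ρ (there (here refl))) v′∈ c∈v′)))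

        distinct-rows : ∀ {p} → CutRankAtMost (bagGraph D a) rows cols p → map blockOf T ⊆ rows → p < length T →
                        Dependent (ZeroOnBlocksOf cols) T
        distinct-rows bag-rank ρ p<T
          with bag-rank (map blockOf T) ρ (subst (_ <_) (sym (length-map blockOf T)) p<T)
        ... | A′ , A′⊆ , A′≢[] , A′-zero with ⊆-map⁻ blockOf T A′⊆
        ...   | T′ , T′⊆T , refl = T′ , T′⊆T , subst (0 <_) (length-map blockOf T′) A′≢[] , T′-zero
          where
          T′-zero : ZeroOnBlocksOf cols T′
          T′-zero {v′} {c} v′∈ c∈v′ = begin
            parity (λ r → edge r c) T′
              ≡⟨ parity-cong T′ (λ r∈T′ → linked-row (Any-resp-⊆ T′⊆T r∈T′) v′∈ c∈v′) ⟩
            parity (λ r → adj D (blockOf r) v′ ∧ linked v′ c) T′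
              ≡⟨ parity-∧ʳ (λ r → adj D (blockOf r) v′) (linked v′ c) T′ ⟩
            parity (λ r → adj D (blockOf r) v′) T′ ∧ linked v′ c
              ≡⟨ cong (_∧ linked v′ c) (sym (parity-map blockOf (λ u → adj D u v′) T′)) ⟩
            parity (λ u → adj D u v′) (map blockOf T′) ∧ linked v′ c
              ≡⟨ cong (_∧ linked v′ c) (sym (Parity⇒≡parityᵇ (A′-zero v′ v′∈))) ⟩
            false
              ∎

      dependent-rows : ∀ {p} → CutRankAtMost (bagGraph D a) rows cols p → p < length T →
                       Dependent (ZeroOnBlocksOf cols) T
      dependent-rows bag-rank p<T with anyᴸ? (λ r → linked (blockOf r) r ≟ᵇ false) T
      ... | yes unlinked = let _ , r∈T , r-unlinked = find unlinked in zero-row r∈T r-unlinked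
      ... | no ¬unlinked with ⊆-concatMap⇒map⊆⊎collision block blockOf rows (OwnedBy-blocks rows⊆B) σ
      ...   | inj₂ (_ , _ , ρ , same-block) = repeated-row (¬Any≡false⇒≡true ¬unlinked) ρ same-block
      ...   | inj₁ ρ = distinct-rows (¬Any≡false⇒≡true ¬unlinked) bag-rank ρ p<T

    ZeroOnRestOfCut : Fin n → List (Fin n) → List (Fin n) → Set
    ZeroOnRestOfCut v right T =
      (∀ {c} → c ∈ right → parity (λ r → edge r c) T ≡ false) ×
      (∀ {v′ c} → v′ ≢ v → Block v′ c → parity (λ r → edge r c) T ≡ false)

    -- All columns outside the component of w, seen from its rows, equal the column of w itself
    -- (up to a constant factor); so they add at most one to the width of the component's layout.
    dependent-rows-in-component : ∀ {v left right T} → InBag v → block v ≡ left ++ right → T ⊆ left →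
                                  suc k < length T → Dependent (ZeroOnRestOfCut v right) T
    dependent-rows-in-component {v} {left} {right} {T} v∈B eq σ k+1<T with partner? v
    ... | no _ = contradiction (≤-trans k+1<T (subst (_ ≤_) (cong length (sym eq)) (length-⊆-prefix σ)))
                               λ { (s≤s ()) }
    ... | yes (w , m) with SameBag? a w
    ...   | yes w∈B = contradiction w∈B (partner∉bag v∈B m)
    ...   | no w∉B with filter-≡-++⁻ (≢? w) (compLayout w w∉B) {left} {right} eq
    ...     | L₁ , L₂ , L≡ , refl , refl = restrict (Dependent-addColumn entry (_∈ L₂) column-w dep k+1<T)
      where
      entry = λ c r → compEdge w r c
      column-w = λ r → compEdge w r w

      dep : ∀ {U} → U ⊆ T → k < length U → Dependent (ZeroOn entry (_∈ L₂)) U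
      dep U⊆T k<U
        with compLayout-width w w∉B L₁ L₂ L≡ _ (⊆-trans U⊆T (⊆-trans σ (filter-⊆ (≢? w) L₁))) k<U
      ... | U′ , U′⊆U , U′≢[] , U′-zero =
            U′ , U′⊆U , U′≢[] , λ c c∈L₂ → sym (Parity⇒≡parity (λ r → altIn? w r c) (U′-zero c c∈L₂))

      in-component : ∀ {x} → x ∈ compLayout w w∉B → Comp D a w x
      in-component x∈ = proj₁ (proj₁ (proj₂ (compLayout-isLayout w w∉B)) _ x∈)

      restrict : Dependent (λ U → ZeroOn entry (_∈ L₂) U × parity column-w U ≡ false) T →
                 Dependent (ZeroOnRestOfCut v (filter (≢? w) L₂)) T
      restrict (T′ , T′⊆T , T′≢[] , T′-zero , T′-zero-on-w) =
        T′ , T′⊆T , T′≢[] , on-right , on-other-blocks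
        where
        row-in-component : ∀ {r} → r ∈ T′ → Comp D a w r
        row-in-component r∈ = in-component (subst (_ ∈_) (sym L≡)
          (∈-++⁺ˡ (Any-resp-⊆ (filter-⊆ (≢? w) L₁) (Any-resp-⊆ σ (Any-resp-⊆ T′⊆T r∈)))))

        on-right : ∀ {c} → c ∈ filter (≢? w) L₂ → parity (λ r → edge r c) T′ ≡ false
        on-right {c} c∈ = trans (parity-cong T′ λ r∈ → edge-within-component v∈B m (row-in-component r∈) cc)
                                (T′-zero c c∈L₂)
          where
          c∈L₂ = proj₁ (∈-filter⁻ (≢? w) {xs = L₂} c∈)
          cc = in-component (subst (_ ∈_) (sym L≡) (∈-++⁺ʳ L₁ c∈L₂))

        on-other-blocks : ∀ {v′ c} → v′ ≢ v → Block v′ c → parity (λ r → edge r c) T′ ≡ false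
        on-other-blocks {v′} {c} v′≢v c∈v′ = begin
          parity (λ r → edge r c) T′                                   ≡⟨ parity-cong T′ row-formula ⟩
          parity (λ r → column-w r ∧ (adj D v v′ ∧ linked v′ c)) T′    ≡⟨ parity-∧ʳ column-w _ T′ ⟩
          parity column-w T′ ∧ (adj D v v′ ∧ linked v′ c)              ≡⟨ cong (_∧ _) T′-zero-on-w ⟩
          false                                                        ∎
          where
          row-formula : ∀ {r} → r ∈ T′ → edge r c ≡ column-w r ∧ (adj D v v′ ∧ linked v′ c)
          row-formula r∈ = trans
            (edge-between-blocks v∈B (proj₁ c∈v′) (v′≢v ∘ sym)
                                 (v∈B , inj₂ (w , m , row-in-component r∈)) c∈v′)
            (cong (_∧ (adj D v v′ ∧ linked v′ c)) (linked-in-component v∈B m (row-in-component r∈)))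

    blockOf-column : ∀ {vs c} → (∀ {v} → v ∈ vs → InBag v) → c ∈ concatMap block vs →
                     ∃ λ v′ → v′ ∈ vs × Block v′ c
    blockOf-column {vs} vs⊆B c∈ with find (∈-concatMap⁻ block {xs = vs} c∈)
    ... | v′ , v′∈vs , c∈v′ = v′ , v′∈vs , proj₂ (block-sound (vs⊆B v′∈vs) c∈v′)

    module FromBagLayout {LB : List (Fin n)} (LB-layout : Layout (bagGraph D a) LB)
                         {p : ℕ} (LB-width : WidthAtMost (bagGraph D a) LB p) where

      LB⊆B : ∀ {v} → v ∈ LB → InBag v
      LB⊆B = proj₁ (proj₂ LB-layout) _

      hatLayout : List (Fin n)
      hatLayout = concatMap block LB

      hatLayout-isLayout : Layout (hatD D) hatLayout
      hatLayout-isLayout =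
        Unique-concatMap block blockOf (proj₁ LB-layout) (λ {v} _ → block-Unique v) (OwnedBy-blocks LB⊆B) ,
        sound , complete
        where
        sound : ∀ x → x ∈ hatLayout → V (hatD D) x
        sound x x∈ with find (∈-concatMap⁻ block {xs = LB} x∈)
        ... | v , v∈LB , x∈v = tt , λ u _ → proj₁ (block-sound (LB⊆B v∈LB) x∈v) u
        complete : ∀ x → V (hatD D) x → x ∈ hatLayout
        complete x (_ , unmarked) with Block-cover x
        ... | v , x∈v@(v∈B , _) =
              ∈-concatMap⁺ block
                (lose (proj₂ (proj₂ LB-layout) v v∈B) (block-complete v∈B (λ u → unmarked u tt) x∈v))

      module AcrossCut {X Y : List (Fin n)} (cut : BlockCut block LB X Y) where
        open BlockCut cut

        LB-Unique : Unique (before ++ v ∷ after)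
        LB-Unique = subst Unique vs≡ (proj₁ LB-layout)

        in-LB : ∀ {u} → u ∈ before ++ v ∷ after → InBag u
        in-LB u∈ = LB⊆B (subst (_ ∈_) (sym vs≡) u∈)

        v∈B : InBag v
        v∈B = in-LB (∈-++⁺ʳ before (here refl))

        v∉after : v ∉ after
        v∉after = Unique.Unique[x∷xs]⇒x∉xs (Unique-++⁻ʳ before LB-Unique)

        column-of-cut : ∀ {c} → c ∈ Y → c ∈ right ⊎ ∃ λ v′ → v′ ∈ after × Block v′ c
        column-of-cut {c} c∈Y with ∈-++⁻ right (subst (c ∈_) Y≡ c∈Y)
        ... | inj₁ c∈right = inj₁ c∈right
        ... | inj₂ c∈after = inj₂ (blockOf-column (in-LB ∘ ∈-++⁺ʳ before ∘ there) c∈after)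

        right-in-block : ∀ {c} → c ∈ right → Block v c
        right-in-block c∈ = proj₂ (block-sound v∈B (subst (_ ∈_) (sym fv≡) (∈-++⁺ʳ left c∈)))

        cut-dependent : ∀ {T} → T ⊆ X → p + suc k < length T → Dependent (ZeroOn (λ c r → edge r c) (_∈ Y)) T
        cut-dependent {T} σ p+k+1<T with ⊆-++-split (concatMap block before) left (subst (T ⊆_) X≡ σ)
        ... | T₁ , T₂ , refl , σ₁ , σ₂ with p <? length T₁
        ...   | yes p<T₁ with RowsOfBlocks.dependent-rows (in-LB ∘ ∈-++⁺ˡ) (Unique-++⇒disjoint before LB-Unique) σ₁
                                (LB-width before (v ∷ after) vs≡) p<T₁
        ...     | T′ , T′⊆T₁ , T′≢[] , T′-zero =
                  T′ , ⊆-trans T′⊆T₁ (++⁺ʳ T₂ ⊆-refl) , T′≢[] , on-column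
          where
          on-column : ∀ c → c ∈ Y → parity (λ r → edge r c) T′ ≡ false
          on-column c c∈Y with column-of-cut c∈Y
          ... | inj₁ c∈right = T′-zero (here refl) (right-in-block c∈right)
          ... | inj₂ (v′ , v′∈after , c∈v′) = T′-zero (there v′∈after) c∈v′
        cut-dependent {T} σ p+k+1<T | T₁ , T₂ , refl , σ₁ , σ₂ | no p≮T₁
          with dependent-rows-in-component v∈B fv≡ σ₂
                 (cut-length-split (subst (p + suc k <_) (length-++ T₁) p+k+1<T) p≮T₁)
        ... | T′ , T′⊆T₂ , T′≢[] , on-right , on-other-blocks =
              T′ , ⊆-trans T′⊆T₂ (++⁺ˡ T₁ ⊆-refl) , T′≢[] , on-column
          where
          on-column : ∀ c → c ∈ Y → parity (λ r → edge r c) T′ ≡ false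
          on-column c c∈Y with column-of-cut c∈Y
          ... | inj₁ c∈right = on-right c∈right
          ... | inj₂ (v′ , v′∈after , c∈v′) = on-other-blocks (λ { refl → v∉after v′∈after }) c∈v′

      hatLayout-width : WidthAtMost (hatD D) hatLayout (p + suc k)
      hatLayout-width X Y eq [] σ ()
      hatLayout-width X Y eq T@(t ∷ _) σ p+k+1<T with concatMap-cut block LB X Y eq
      ... | inj₁ refl = [ t ] , from∈ (here refl) , s≤s z≤n , λ _ ()
      ... | inj₂ cut with AcrossCut.cut-dependent cut σ p+k+1<T
      ...   | T′ , T′⊆T , T′≢[] , T′-zero = T′ , T′⊆T , T′≢[] , λ c c∈Y →
              subst (Parity _ T′) (T′-zero c c∈Y) (Parity-parity (λ r → altWalk? r c) T′)

lemma3p2 : ∀ {n} (D : MarkedGraph n) → Canonical D →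
    (a b : Fin n) → Unmarked D a → Unmarked D b → a ≢ b → SameBag D a b →
    (p k : ℕ) → 1 ≤ p →
    (∀ r → ¬ SameBag D a r → LrwAtMost (hat D (Comp D a r)) k) →
    (Σ (List (Fin n)) λ L → Layout (bagGraph D a) L × WidthAtMost (bagGraph D a) L p ×
       head L ≡ just a × last L ≡ just b) →
    Σ (List (Fin n)) λ L → Layout (hatD D) L × WidthAtMost (hatD D) L (2 * p + k) ×
       head L ≡ just a × last L ≡ just b
lemma3p2 D _ a b a-unmarked b-unmarked _ _ p k 1≤p comp-layouts (LB , LB-layout , LB-width , head≡a , last≡b) =
  hatLayout ,
  hatLayout-isLayout ,
  WidthAtMost-mono {G = hatD D} {L = hatLayout} (p+1+k≤2p+k k 1≤p) hatLayout-width ,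
  head-concatMap block LB head≡a (block-unmarked a-unmarked) ,
  last-concatMap block LB last≡b (block-unmarked b-unmarked)
  where
  open BlockLists D a comp-layouts
  open FromBagLayout LB-layout LB-width
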